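{- Let $X$ be a complete lattice of dense order and $O$ a residuated quasi-overlap function on $X$, with induced implication $I_O(x,y)=\sup\{t\in X\mid O(x,t)\leq y\}$. Then: (i) if $I_O$ satisfies the exchange principle $I_O(x,I_O(y,z))=I_O(y,I_O(x,z))$ for all $x,y,z\in X$, and $O(x,O(y,z))$ and $O(y,O(x,z))$ are comparable for all $x,y,z\in X$, then $O$ is associative; (ii) if $O$ is associative, then $I_O$ satisfies the exchange principle $I_O(x,I_O(y,z))=I_O(y,I_O(x,z))$ for all $x,y,z\in X$.
   Context: $X$ is a complete lattice (bottom $0$, top $1$) of dense order: for all $x<y$ there is $z$ with $x<z<y$. A quasi-overlap function on $X$ is $O:X^2\to X$ with (OL1) $O(x,y)=O(y,x)$; (OL2) $O(x,y)=0$ iff $x=0$ or $y=0$; (OL3) $O(x,y)=1$ iff $x=y=1$; (OL4) $O$ non-decreasing in each variable. $O$ is called residuated if it is Scott-continuous (preserves suprema of directed subsets of $X^2$ with the componentwise order), equivalently if $O(x,z)\leq y\iff z\leq I_O(x,y)$ for all $x,y,z$, equivalently if $I_O(x,y)=\max\{t\mid O(x,t)\leq y\}$ for all $x,y$. -}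

module Defs where

open import Level using (Level; _⊔_; suc; Lift; lift)
open import Data.Empty using (⊥)
open import Data.Unit using (⊤)
open import Data.Sum using (_⊎_)
open import Data.Product using (_×_; ∃)
open import Relation.Nullary using (¬_)
open import Relation.Unary using (Pred)
open import Relation.Binary.Bundles using (Poset)
open import Function.Bundles using (_⇔_)

record CompleteLattice (c ℓ₁ ℓ₂ : Level) : Set (suc (c ⊔ ℓ₁ ⊔ ℓ₂)) where
  field
    poset : Poset c ℓ₁ ℓ₂
  open Poset poset public
  field
    ⋁        : Pred Carrier ℓ₂ → Carrier
    ⋁-upper  : (S : Pred Carrier ℓ₂) (x : Carrier) → S x → x ≤ ⋁ S
    ⋁-least  : (S : Pred Carrier ℓ₂) (y : Carrier) →
               ((x : Carrier) → S x → x ≤ y) → ⋁ S ≤ y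

  _<_ : Carrier → Carrier → Set (ℓ₁ ⊔ ℓ₂)
  x < y = x ≤ y × ¬ (x ≈ y)

  𝟘 : Carrier
  𝟘 = ⋁ (λ _ → Lift ℓ₂ ⊥)

  𝟙 : Carrier
  𝟙 = ⋁ (λ _ → Lift ℓ₂ ⊤)

module _ {c ℓ₁ ℓ₂} (X : CompleteLattice c ℓ₁ ℓ₂) where
  open CompleteLattice X

  DenseOrder : Set (c ⊔ ℓ₁ ⊔ ℓ₂)
  DenseOrder = ∀ x y → x < y → ∃ λ z → x < z × z < y

  record IsQuasiOverlap (O : Carrier → Carrier → Carrier) : Set (c ⊔ ℓ₁ ⊔ ℓ₂) where
    field
      OL1  : ∀ x y → O x y ≈ O y x
      OL2  : ∀ x y → (O x y ≈ 𝟘) ⇔ (x ≈ 𝟘 ⊎ y ≈ 𝟘)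
      OL3  : ∀ x y → (O x y ≈ 𝟙) ⇔ (x ≈ 𝟙 × y ≈ 𝟙)
      OL4ˡ : ∀ {x x′} y → x ≤ x′ → O x y ≤ O x′ y
      OL4ʳ : ∀ x {y y′} → y ≤ y′ → O x y ≤ O x y′

  I[_] : (Carrier → Carrier → Carrier) → Carrier → Carrier → Carrier
  I[ O ] x y = ⋁ (λ t → O x t ≤ y)

  Residuated : (Carrier → Carrier → Carrier) → Set (c ⊔ ℓ₂)
  Residuated O = ∀ x y z → (O x z ≤ y) ⇔ (z ≤ I[ O ] x y)

  Associative : (Carrier → Carrier → Carrier) → Set (c ⊔ ℓ₁)
  Associative O = ∀ x y z → O x (O y z) ≈ O (O x y) z

  ExchangePrinciple : (Carrier → Carrier → Carrier) → Set (c ⊔ ℓ₁)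
  ExchangePrinciple I = ∀ x y z → I x (I y z) ≈ I y (I x z)

-- Residuation turns O y (O x t) ≤ z into t ≤ I x (I y z), so by Yoneda the exchange
-- principle for I_O is equivalent to left-commutativity O x (O y t) ≈ O y (O x t)
-- of O; for a commutative O, left-commutativity is equivalent to associativity.

module Submission where

open import Defs
open import Data.Sum using (_⊎_)
open import Data.Product using (_×_; _,_)
open import Function.Bundles using (_⇔_; mk⇔; Equivalence)
open import Level using (_⊔_)

module _ {c ℓ₁ ℓ₂} (X : CompleteLattice c ℓ₁ ℓ₂) where
  open CompleteLattice X

  LeftCommutative : (Carrier → Carrier → Carrier) → Set (c ⊔ ℓ₁)
  LeftCommutative O = ∀ x y t → O x (O y t) ≈ O y (O x t)

  module Residuation {O : Carrier → Carrier → Carrier} (residuated : Residuated X O) where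
    open Equivalence

    private
      I : Carrier → Carrier → Carrier
      I = I[_] X O

    residuated₂ : ∀ x y z t → (O y (O x t) ≤ z) ⇔ (t ≤ I x (I y z))
    residuated₂ x y z t = mk⇔
      (λ h → to (residuated x (I y z) t) (to (residuated y z (O x t)) h))
      (λ h → from (residuated y z (O x t)) (from (residuated x (I y z) t) h))

    exchange⇒leftCommutative : ExchangePrinciple X I → LeftCommutative O
    exchange⇒leftCommutative exchange x y t = antisym (swap-≤ x y) (swap-≤ y x)
      where
      swap-≤ : ∀ x y → O x (O y t) ≤ O y (O x t)
      swap-≤ x y = from (residuated₂ y x _ t)
        (trans (to (residuated₂ x y _ t) refl) (reflexive (exchange x y _)))

    leftCommutative⇒exchange : LeftCommutative O → ExchangePrinciple X I
    leftCommutative⇒exchange leftComm x y z = antisym (swap-≤ x y) (swap-≤ y x)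
      where
      swap-≤ : ∀ x y → I x (I y z) ≤ I y (I x z)
      swap-≤ x y = to (residuated₂ y x z _)
        (trans (reflexive (leftComm x y _)) (from (residuated₂ x y z _) refl))

  module QuasiOverlapLaws {O : Carrier → Carrier → Carrier} (quasiOverlap : IsQuasiOverlap X O) where
    open IsQuasiOverlap quasiOverlap

    O-cong : ∀ {a a′ b b′} → a ≈ a′ → b ≈ b′ → O a b ≈ O a′ b′
    O-cong {a} {a′} {b} {b′} a≈a′ b≈b′ = antisym
      (trans (OL4ˡ b (reflexive a≈a′)) (OL4ʳ a′ (reflexive b≈b′)))
      (trans (OL4ˡ b′ (reflexive (Eq.sym a≈a′))) (OL4ʳ a (reflexive (Eq.sym b≈b′))))

    leftCommutative⇒associative : LeftCommutative O → Associative X O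
    leftCommutative⇒associative leftComm x y z = begin
      O x (O y z)  ≈⟨ O-cong Eq.refl (OL1 y z) ⟩
      O x (O z y)  ≈⟨ leftComm x z y ⟩
      O z (O x y)  ≈⟨ OL1 z (O x y) ⟩
      O (O x y) z  ∎
      where open import Relation.Binary.Reasoning.Setoid Eq.setoid

    associative⇒leftCommutative : Associative X O → LeftCommutative O
    associative⇒leftCommutative assoc x y t = begin
      O x (O y t)  ≈⟨ assoc x y t ⟩
      O (O x y) t  ≈⟨ O-cong (OL1 x y) Eq.refl ⟩
      O (O y x) t  ≈⟨ assoc y x t ⟨
      O y (O x t)  ∎
      where open import Relation.Binary.Reasoning.Setoid Eq.setoid

proposition3p5 : ∀ {c ℓ₁ ℓ₂} (X : CompleteLattice c ℓ₁ ℓ₂) →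
    DenseOrder X →
    (O : CompleteLattice.Carrier X → CompleteLattice.Carrier X → CompleteLattice.Carrier X) →
    IsQuasiOverlap X O →
    Residuated X O →
    ((ExchangePrinciple X (I[_] X O) →
      (∀ x y z → CompleteLattice._≤_ X (O x (O y z)) (O y (O x z))
                 ⊎ CompleteLattice._≤_ X (O y (O x z)) (O x (O y z))) →
      Associative X O)
    × (Associative X O → ExchangePrinciple X (I[_] X O)))
proposition3p5 X _ O quasiOverlap residuated =
    (λ exchange _ → leftCommutative⇒associative (exchange⇒leftCommutative exchange))
  , (λ assoc → leftCommutative⇒exchange (associative⇒leftCommutative assoc))
  where
  open Residuation X residuated
  open QuasiOverlapLaws X quasiOverlap
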